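{- Let $D$ be a non-elliptic web all of whose boundary vertices have degree exactly $1$, with boundary vertices numbered $1,\dots,n$ clockwise, and let $(j_1,\dots,j_n)$ be its KK-labeling. Then there is exactly one proper edge coloring of $D$ in which, for each $k$, the edge incident to boundary vertex $k$ has color $j_k$ if vertex $k$ is black and color $-j_k$ if vertex $k$ is white.
   Context: A tensor diagram is a finite bipartite graph with a fixed proper coloring of its vertices by black and white, a fixed partition of its vertices into boundary vertices and internal vertices, such that every internal vertex has degree $3$ and carries a fixed cyclic order of its incident edges. A web is a tensor diagram embedded in an oriented disk, with the boundary vertices on the boundary circle, whose edges do not cross or touch except at endpoints (considered up to isotopy fixing the boundary). A web is non-elliptic if it has no multiple edges and no $4$-cycle all of whose vertices are internal. A proper edge coloring is an assignment of a color in $\{ -1,0,1\}$ to each edge such that the three edges at every internal vertex receive distinct colors. Sign and state strings: a sign and state string of length $n$ is a sequence $((s_1,j_1),\dots,(s_n,j_n))$ with $s_k\in\{+,-\}$, $j_k\in\{ -1,0,1\}$. Weights in $\mathbb{R}^2$: $(+,1)\mapsto(1,0)$, $(+,0)\mapsto(-1/2,\sqrt3/2)$, $(+,-1)\mapsto(-1/2,-\sqrt3/2)$, and the weight of $(-,j)$ is the negative of the weight of $(+,-j)$. The path is $\pi_0=0$, $\pi_k=\pi_{k-1}+(\text{weight of }(s_k,j_k))$; the string is dominant if $\pi_n=0$ and all $\pi_k$ lie in $\{a(1,0)+b(1/2,\sqrt3/2): a,b\ge0\}$. Growth algorithm (Khovanov–Kuperberg): place $n$ vertices on a horizontal segment in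 order $1,\dots,n$ left to right, vertex $k$ black if $s_k=+$ and white if $s_k=-$, with a downward dangling edge labeled $(s_k,j_k)$. Repeatedly apply a rule to two dangling edges adjacent in the current left-to-right order, labeled $(s,j)$ (left) and $(s',j')$ (right). If $s'=-s$: (i) if $(j,j')=(1,0)$, $(0,0)$, or $(0,-1)$, join each edge to a new internal vertex, connect the two new vertices by a horizontal edge, and draw from each a new downward dangling edge, labeled (left, right) $(-s,0),(s,1)$, resp. $(-s,-1),(s,1)$, resp. $(-s,-1),(s,0)$; (ii) if $(j,j')=(1,-1)$, join the two dangling edges into one edge. If $s'=s$ and $(j,j')=(1,0)$, $(0,-1)$, or $(1,-1)$: join both to a new internal vertex with one new downward dangling edge labeled $(-s,1)$, resp. $(-s,-1)$, resp. $(-s,0)$. Finally the ends of the segment are joined so the web lies in a disk and left-to-right becomes clockwise. Khovanov and Kuperberg showed that from a dominant string this terminates in a non-elliptic web with all boundary vertices of degree $1$, independent of choices, and that every such web with boundary numbered $1,\dots,n$ clockwise arises from exactly one dominant string, with $s_k=+$ iff vertex $k$ is black. Its state string $(j_1,\dots,j_n)$ is the KK-labeling of the web. -}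

module Defs where

open import Data.Nat using (ℕ; zero; suc; _≤_)
open import Data.Integer as ℤ using (ℤ; +_; -[1+_])
open import Data.Fin using (Fin; toℕ)
open import Data.List using (List; []; _∷_; _++_; length; lookup)
open import Data.Product using (_×_; _,_; Σ)
open import Data.Sum using (_⊎_)
open import Relation.Binary.PropositionalEquality using (_≡_; _≢_)
open import Relation.Binary.Construct.Closure.ReflexiveTransitive using (Star)

data Sgn : Set where
  plus minus : Sgn

negS : Sgn → Sgn
negS plus  = minus
negS minus = plus

data Col : Set where
  m1 z0 p1 : Col

negC : Col → Col
negC m1 = p1
negC z0 = z0
negC p1 = m1

Label : Set
Label = Sgn × Col

-- We write a point of R^2 in the (real) basis
--   e₁ = (1,0),  ω = (1/2, √3/2)
-- so a vector x e₁ + y ω is the integer pair (x , y).  Then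
--   (+, 1) ↦ (1,0) = e₁,  (+,0) ↦ (-1/2,√3/2) = ω - e₁,  (+,-1) ↦ -ω,
-- and (-, j) ↦ - weight (+, -j).  The dominant cone
-- {a(1,0)+b(1/2,√3/2) : a,b ≥ 0} is exactly {x ≥ 0, y ≥ 0}.

weight : Label → ℤ × ℤ
weight (plus  , p1) = (+ 1 , + 0)
weight (plus  , z0) = (-[1+ 0 ] , + 1)
weight (plus  , m1) = (+ 0 , -[1+ 0 ])
weight (minus , p1) = (+ 0 , + 1)
weight (minus , z0) = (+ 1 , -[1+ 0 ])
weight (minus , m1) = (-[1+ 0 ] , + 0)

DomFrom : ℤ × ℤ → List Label → Set
DomFrom (x , y) [] = x ≡ + 0 × y ≡ + 0
DomFrom (x , y) (l ∷ w) with weight l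
... | (dx , dy) = (+ 0 ℤ.≤ (x ℤ.+ dx) × + 0 ℤ.≤ (y ℤ.+ dy))
                  × DomFrom (x ℤ.+ dx , y ℤ.+ dy) w

Dominant : List Label → Set
Dominant w = DomFrom (+ 0 , + 0) w

-- A stage  st N es ds  consists of
--   N  : number of vertices created so far (vertices are 0 … N-1;
--        the boundary vertices are 0 … n-1, vertex k-1 being boundary
--        vertex k, of colour black iff s_k = +),
--   es : the (complete) edges drawn so far, as pairs of vertex ids,
--   ds : the dangling edges in left-to-right order, each given by the
--        vertex it hangs from together with its label (s , j).
-- (The sign of a dangling label is always the colour of the vertex it
-- hangs from: + = black, - = white.)

data State : Set where
  st : ℕ → List (ℕ × ℕ) → List (ℕ × Label) → State

-- rule (i):  (j , j') ↦ new labels (left , right) states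
data HRule : Col → Col → Col → Col → Set where
  h10  : HRule p1 z0 z0 p1
  h00  : HRule z0 z0 m1 p1
  h0-1 : HRule z0 m1 m1 z0

-- same-sign rule: (j , j') ↦ state of the new dangling edge
data YRule : Col → Col → Col → Set where
  y10   : YRule p1 z0 p1
  y0-1  : YRule z0 m1 m1
  y1-1  : YRule p1 m1 z0

data Step : State → State → Set where
  H : ∀ {N es} (L R : List (ℕ × Label)) (u v : ℕ) (s : Sgn) {j j' jl jr : Col} →
      HRule j j' jl jr →
      Step (st N es (L ++ (u , (s , j)) ∷ (v , (negS s , j')) ∷ R))
           (st (suc (suc N)) ((u , N) ∷ (v , suc N) ∷ (N , suc N) ∷ es)
               (L ++ (N , (negS s , jl)) ∷ (suc N , (s , jr)) ∷ R))
  J : ∀ {N es} (L R : List (ℕ × Label)) (u v : ℕ) (s : Sgn) →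
      Step (st N es (L ++ (u , (s , p1)) ∷ (v , (negS s , m1)) ∷ R))
           (st N ((u , v) ∷ es) (L ++ R))
  Y : ∀ {N es} (L R : List (ℕ × Label)) (u v : ℕ) (s : Sgn) {j j' jn : Col} →
      YRule j j' jn →
      Step (st N es (L ++ (u , (s , j)) ∷ (v , (s , j')) ∷ R))
           (st (suc N) ((u , N) ∷ (v , N) ∷ es)
               (L ++ (N , (negS s , jn)) ∷ R))

initDangling : ℕ → List Label → List (ℕ × Label)
initDangling k []      = []
initDangling k (l ∷ w) = (k , l) ∷ initDangling (suc k) w

initState : List Label → State
initState w = st (length w) [] (initDangling 0 w)

GrowsTo : List Label → List (ℕ × ℕ) → Set
GrowsTo w es = Σ ℕ (λ N → Star Step (initState w) (st N es []))

Incident : ℕ × ℕ → ℕ → Set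
Incident (a , b) v = a ≡ v ⊎ b ≡ v

EdgeColoring : List (ℕ × ℕ) → Set
EdgeColoring es = Fin (length es) → Col

Proper : ℕ → (es : List (ℕ × ℕ)) → EdgeColoring es → Set
Proper n es c = ∀ (v : ℕ) → n ≤ v → ∀ (e e' : Fin (length es)) → e ≢ e' →
  Incident (lookup es e) v → Incident (lookup es e') v → c e ≢ c e'

boundaryColor : Label → Col
boundaryColor (plus  , j) = j
boundaryColor (minus , j) = negC j

BoundaryOK : (w : List Label) (es : List (ℕ × ℕ)) → EdgeColoring es → Set
BoundaryOK w es c = ∀ (k : Fin (length w)) (e : Fin (length es)) →
  Incident (lookup es e) (toℕ k) → c e ≡ boundaryColor (lookup w k)

GoodColoring : List Label → (es : List (ℕ × ℕ)) → EdgeColoring es → Set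
GoodColoring w es c = Proper (length w) es c × BoundaryOK w es c

-- Colour every edge when the growth algorithm creates it, with the colour required by the
-- label of the dangling edge it replaces (the middle edge of rule (i) gets the colour required by (s , -1)).
-- Record at each vertex its slots: the ends of edges and the dangling edges, with their colours. A step moves
-- the slots of the consumed dangling edges onto the new edges without changing colours, and adds three slots
-- of distinct colours at each new vertex; so the colours at every vertex stay distinct.
--
-- Fix a run and a proper colouring. Each dangling edge of a stage is eventually continued by an
-- edge of the final web, whose colour determines an observed label. In simple-root coordinates all partial
-- sums of (actual weight - observed weight) are nonnegative: this holds trivially at the end of the run,
-- and every rule preserves it backwards since the colours at a vertex are distinct. Going forwards from the
-- boundary, where observed = actual, distinctness forces the colours of each step, except in rule (i) with
-- states (0 , 0): there the wrong middle colour would make the next partial sum negative.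

module Submission where

open import Defs
open import Data.Nat as ℕ using (ℕ; zero; suc; _≤_; _<_)
open import Data.Nat.Properties as ℕP using (≤-refl; ≤-trans; <-≤-trans; <⇒≢; n≤1+n)
open import Data.Integer as ℤ using (ℤ; +_; _⊖_)
open import Data.Integer.Properties as ℤP using ()
open import Data.Fin using (Fin; toℕ; zero; suc)
open import Data.Fin.Properties using (toℕ<n; toℕ-injective)
open import Data.List using (List; []; _∷_; [_]; _++_; length; lookup; map; foldl)
open import Data.List.Properties using (map-++; ++-identityʳ)
open import Data.List.Membership.Propositional using (_∈_)
open import Data.List.Relation.Unary.Any using (here; there)
open import Data.List.Relation.Unary.All as All using (All; []; _∷_)
import Data.List.Relation.Unary.All.Properties as All
open import Data.List.Relation.Unary.AllPairs as AllPairs using (AllPairs; []; _∷_)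
import Data.List.Relation.Unary.AllPairs.Properties as AllPairs
open import Data.List.Relation.Unary.Unique.Propositional using (Unique)
open import Data.List.Relation.Binary.Permutation.Propositional using (_↭_; ↭-refl; ↭-sym; ↭⇒↭ₛ)
open import Data.List.Relation.Binary.Permutation.Propositional.Properties using (All-resp-↭; ++-commutativeMonoid)
import Data.List.Relation.Binary.Permutation.Setoid.Properties as Perm
open import Data.Product as Product using (Σ; _×_; _,_; proj₁; proj₂; uncurry)
open import Data.Sum using (_⊎_; inj₁; inj₂)
open import Data.Unit using (⊤; tt)
open import Data.Empty using (⊥-elim)
open import Function using (_∘_)
open import Relation.Nullary using (Dec; yes; no; contradiction)
open import Relation.Nullary.Decidable using (map′; _×-dec_; _⊎-dec_; _→-dec_; toWitness; True)
open import Relation.Binary.Definitions using (DecidableEquality)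
open import Relation.Binary.PropositionalEquality
  using (_≡_; _≢_; refl; sym; trans; cong; cong₂; subst; subst₂; ≢-sym; setoid; module ≡-Reasoning)
open import Relation.Binary.Construct.Closure.ReflexiveTransitive using (Star; ε; _◅_)
import Algebra.Solver.CommutativeMonoid

module PartialSums {A : Set} (f : A → ℤ) where

  total : ℤ → List A → ℤ
  total = foldl (λ D x → D ℤ.+ f x)

  Nonneg : ℤ → List A → Set
  Nonneg D []       = ⊤
  Nonneg D (x ∷ xs) = + 0 ℤ.≤ D ℤ.+ f x × Nonneg (D ℤ.+ f x) xs

  ++⁻ : ∀ {D} xs {ys} → Nonneg D (xs ++ ys) → Nonneg D xs × Nonneg (total D xs) ys
  ++⁻ []       n       = tt , n
  ++⁻ (x ∷ xs) (d , n) = Product.map₁ (d ,_) (++⁻ xs n)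

  ++⁺ : ∀ {D} xs {ys} → Nonneg D xs → Nonneg (total D xs) ys → Nonneg D (xs ++ ys)
  ++⁺ []       _       n = n
  ++⁺ (x ∷ xs) (d , m) n = d , ++⁺ xs m n

  total-nonneg : ∀ {D} xs → + 0 ℤ.≤ D → Nonneg D xs → + 0 ℤ.≤ total D xs
  total-nonneg []       d _       = d
  total-nonneg (x ∷ xs) _ (d , n) = total-nonneg xs d n

  total-zeros : ∀ {D xs} → All (λ x → f x ≡ + 0) xs → total D xs ≡ D
  total-zeros []                       = refl
  total-zeros {D} {x ∷ xs} (fx≡0 ∷ zs) = begin
    total (D ℤ.+ f x) xs  ≡⟨ cong (λ e → total (D ℤ.+ e) xs) fx≡0 ⟩
    total (D ℤ.+ + 0) xs  ≡⟨ cong (λ e → total e xs) (ℤP.+-identityʳ D) ⟩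
    total D xs            ≡⟨ total-zeros zs ⟩
    D                     ∎
    where open ≡-Reasoning

  replace : ∀ xs {B B' ys} → (∀ D → total D B ≡ total D B') →
            (∀ {D} → + 0 ℤ.≤ D → Nonneg D B' → Nonneg D B) →
            Nonneg (+ 0) (xs ++ B' ++ ys) → Nonneg (+ 0) (xs ++ B ++ ys)
  replace xs {B} {B'} same local n =
    let nxs , n'  = ++⁻ xs n
        nB' , nys = ++⁻ B' n'
    in ++⁺ xs nxs (++⁺ B (local (total-nonneg xs ℤP.≤-refl nxs) nB') (subst (λ D → Nonneg D _) (sym (same _)) nys))

  private
    pair-total : ∀ D a b → total D (a ∷ b ∷ []) ≡ D ℤ.+ (f a ℤ.+ f b)
    pair-total D a b = ℤP.+-assoc D (f a) (f b)

    pair-nonneg : ∀ {a b B'} → (∀ D → total D (a ∷ b ∷ []) ≡ total D B') →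
                  (∀ {D} → + 0 ℤ.≤ D → Nonneg D B' → + 0 ℤ.≤ D ℤ.+ f a) →
                  ∀ {D} → + 0 ℤ.≤ D → Nonneg D B' → Nonneg D (a ∷ b ∷ [])
    pair-nonneg {B' = B'} same first d n =
      first d n , subst (+ 0 ℤ.≤_) (sym (same _)) (total-nonneg B' d n) , tt

    first-term : ∀ {D u u'} → + 0 ℤ.≤ D → + 0 ℤ.≤ D ℤ.+ u' → u' ℤ.≤ u ⊎ + 0 ℤ.≤ u →
                 + 0 ℤ.≤ D ℤ.+ u
    first-term {D} _ d' (inj₁ u'≤u) = ℤP.≤-trans d' (ℤP.+-monoʳ-≤ D u'≤u)
    first-term     d _  (inj₂ u≥0)  = ℤP.+-mono-≤ d u≥0

  two-for-two : ∀ xs {a b a' b' ys} → f a ℤ.+ f b ≡ f a' ℤ.+ f b' → f a' ℤ.≤ f a ⊎ + 0 ℤ.≤ f a →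
                Nonneg (+ 0) (xs ++ a' ∷ b' ∷ ys) → Nonneg (+ 0) (xs ++ a ∷ b ∷ ys)
  two-for-two xs {a} {b} {a'} {b'} sum≡ start = replace xs same (pair-nonneg same λ d n → first-term d (proj₁ n) start)
    where
    same : ∀ D → total D (a ∷ b ∷ []) ≡ total D (a' ∷ b' ∷ [])
    same D = trans (pair-total D a b) (trans (cong (λ e → D ℤ.+ e) sum≡) (sym (pair-total D a' b')))

  two-for-one : ∀ xs {a b a' ys} → f a ℤ.+ f b ≡ f a' → f a' ℤ.≤ f a ⊎ + 0 ℤ.≤ f a →
                Nonneg (+ 0) (xs ++ a' ∷ ys) → Nonneg (+ 0) (xs ++ a ∷ b ∷ ys)
  two-for-one xs {a} {b} sum≡ start = replace xs same (pair-nonneg same λ d n → first-term d (proj₁ n) start)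
    where
    same : ∀ D → total D (a ∷ b ∷ []) ≡ total D (_ ∷ [])
    same D = trans (pair-total D a b) (cong (λ e → D ℤ.+ e) sum≡)

  two-for-none : ∀ xs {a b ys} → f a ℤ.+ f b ≡ + 0 → + 0 ℤ.≤ f a →
                 Nonneg (+ 0) (xs ++ ys) → Nonneg (+ 0) (xs ++ a ∷ b ∷ ys)
  two-for-none xs {a} {b} sum≡ a≥0 = replace xs same (pair-nonneg same λ d _ → ℤP.+-mono-≤ d a≥0)
    where
    same : ∀ D → total D (a ∷ b ∷ []) ≡ total D []
    same D = trans (pair-total D a b) (trans (cong (λ e → D ℤ.+ e) sum≡) (ℤP.+-identityʳ D))

record Spliced {A : Set} (xs xs' B B' : List A) : Set where
  field
    left right : List A
    xs≡        : xs  ≡ left ++ B ++ right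
    xs'≡       : xs' ≡ left ++ B' ++ right

module _ {A : Set} {xs xs' B B' : List A} (view : Spliced xs xs' B B') where

  open Spliced view

  spliced-transfer : (P : List A → Set) → (∀ ys zs → P (ys ++ B' ++ zs) → P (ys ++ B ++ zs)) → P xs' → P xs
  spliced-transfer P step p = subst P (sym xs≡) (step left right (subst P xs'≡ p))

  spliced-All⁻ : ∀ {P : A → Set} → All P xs → All P left × All P B × All P right
  spliced-All⁻ {P} ps with All.++⁻ left (subst (All P) xs≡ ps)
  ... | pl , pr = pl , All.++⁻ˡ B pr , All.++⁻ʳ B pr

  spliced-All⁺ : ∀ {P : A → Set} → All P left → All P B' → All P right → All P xs'
  spliced-All⁺ {P} pl pB' pr = subst (All P) (sym xs'≡) (All.++⁺ pl (All.++⁺ pB' pr))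

module _ {A : Set} {P Q : A → Set} where

  splice : ∀ L M' {M R} → (∀ {x} → P x → Q x) → All Q M → All P (L ++ M' ++ R) → All Q (L ++ M ++ R)
  splice L M' f qs ps = All.++⁺ (All.map f (All.++⁻ˡ L ps)) (All.++⁺ qs (All.map f (All.++⁻ʳ M' (All.++⁻ʳ L ps))))

  reduce-++⁺ : ∀ {B : Set} (g : ∀ {x} → Q x → B) {xs ys : List A} (qs : All Q xs) (qs' : All Q ys) →
               All.reduce g (All.++⁺ qs qs') ≡ All.reduce g qs ++ All.reduce g qs'
  reduce-++⁺ g []       qs' = refl
  reduce-++⁺ g (q ∷ qs) qs' = cong (g q ∷_) (reduce-++⁺ g qs qs')

  reduce-map : ∀ {B : Set} (g : ∀ {x} → Q x → B) (f : ∀ {x} → P x → Q x) {xs : List A} (ps : All P xs) →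
               All.reduce g (All.map f ps) ≡ All.reduce (λ p → g (f p)) ps
  reduce-map g f []       = refl
  reduce-map g f (p ∷ ps) = cong (g (f p) ∷_) (reduce-map g f ps)

  reduce-splice : ∀ {B : Set} (g : ∀ {x} → Q x → B) L M' {M R} (f : ∀ {x} → P x → Q x) (qs : All Q M)
                  (ps : All P (L ++ M' ++ R)) →
                  All.reduce g (splice L M' f qs ps)
                  ≡ All.reduce (λ p → g (f p)) (All.++⁻ˡ L ps) ++ All.reduce g qs
                    ++ All.reduce (λ p → g (f p)) (All.++⁻ʳ M' (All.++⁻ʳ L ps))
  reduce-splice g L M' f qs ps = begin
    All.reduce g (splice L M' f qs ps)
      ≡⟨ reduce-++⁺ g (All.map f (All.++⁻ˡ L ps)) _ ⟩
    All.reduce g (All.map f (All.++⁻ˡ L ps)) ++ All.reduce g (All.++⁺ qs (All.map f rest))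
      ≡⟨ cong₂ _++_ (reduce-map g f (All.++⁻ˡ L ps))
                    (trans (reduce-++⁺ g qs _) (cong (All.reduce g qs ++_) (reduce-map g f rest))) ⟩
    _ ∎
    where
    open ≡-Reasoning
    rest = All.++⁻ʳ M' (All.++⁻ʳ L ps)

reduce-all : ∀ {A B : Set} {P Q : A → Set} {R : B → Set} (g : ∀ {x} → P x → B) →
             (∀ {x} (p : P x) → Q x → R (g p)) → ∀ {xs} (ps : All P xs) → All Q xs → All R (All.reduce g ps)
reduce-all g f []       []       = []
reduce-all g f (p ∷ ps) (q ∷ qs) = f p q ∷ reduce-all g f ps qs

reduce-++⁻ : ∀ {A B : Set} {P : A → Set} (g : ∀ {x} → P x → B) (L : List A) {ys : List A} (ps : All P (L ++ ys)) →
             All.reduce g ps ≡ All.reduce g (All.++⁻ˡ L ps) ++ All.reduce g (All.++⁻ʳ L ps)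
reduce-++⁻ g []      ps       = refl
reduce-++⁻ g (_ ∷ L) (p ∷ ps) = cong (g p ∷_) (reduce-++⁻ g L ps)

_≟ᶜ_ : DecidableEquality Col
m1 ≟ᶜ m1 = yes refl
m1 ≟ᶜ z0 = no λ ()
m1 ≟ᶜ p1 = no λ ()
z0 ≟ᶜ m1 = no λ ()
z0 ≟ᶜ z0 = yes refl
z0 ≟ᶜ p1 = no λ ()
p1 ≟ᶜ m1 = no λ ()
p1 ≟ᶜ z0 = no λ ()
p1 ≟ᶜ p1 = yes refl

open import Data.List.Relation.Unary.Unique.DecPropositional _≟ᶜ_ using (unique?)

Rainbow : Col → Col → Col → Set
Rainbow a b c = Unique (a ∷ b ∷ c ∷ [])

rainbow? : ∀ a b c → Dec (Rainbow a b c)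
rainbow? a b c = unique? (a ∷ b ∷ c ∷ [])

boundaryColor-involutive : ∀ s j → boundaryColor (s , boundaryColor (s , j)) ≡ j
boundaryColor-involutive plus  j  = refl
boundaryColor-involutive minus m1 = refl
boundaryColor-involutive minus z0 = refl
boundaryColor-involutive minus p1 = refl

data Root : Set where
  α₁ α₂ : Root

-- weight (s , j) - weight (s , m1) = height α₁ (s , j) · α₁ + height α₂ (s , j) · α₂,
-- for the simple roots α₁ = 2e₁ - ω and α₂ = 2ω - e₁.
height : Root → Label → ℕ
height α₁ (plus  , p1) = 1
height α₁ (plus  , _)  = 0
height α₁ (minus , m1) = 0
height α₁ (minus , _)  = 1
height α₂ (plus  , m1) = 0
height α₂ (plus  , _)  = 1
height α₂ (minus , p1) = 1
height α₂ (minus , _)  = 0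

-- (s , boundaryColor (s , c)) is the label requiring colour c, since boundaryColor (s , _) is an involution.
excess : Root → Label → Col → ℤ
excess k (s , j) c = height k (s , j) ⊖ height k (s , boundaryColor (s , c))

excess-canonical : ∀ k l → excess k l (boundaryColor l) ≡ + 0
excess-canonical k (s , j) rewrite boundaryColor-involutive s j = ℤP.n⊖n≡0 (height k (s , j))

Canonical : List (Label × Col) → Set
Canonical = All (λ (l , col) → col ≡ boundaryColor l)

Dominated : List (Label × Col) → Set
Dominated obs = ∀ k → PartialSums.Nonneg (uncurry (excess k)) (+ 0) obs

canonical-prefix : ∀ xs {a ys} → Canonical xs → Dominated (xs ++ a ∷ ys) → ∀ k → + 0 ℤ.≤ uncurry (excess k) a
canonical-prefix xs {a} C D k = subst (+ 0 ℤ.≤_) start (proj₁ (proj₂ (++⁻ xs (D k))))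
  where
  open PartialSums (uncurry (excess k))
  start : total (+ 0) xs ℤ.+ uncurry (excess k) a ≡ uncurry (excess k) a
  start = trans (cong (ℤ._+ uncurry (excess k) a)
                      (total-zeros (All.map (λ {(l , _)} col≡ → trans (cong (excess k l) col≡) (excess-canonical k l)) C)))
                (ℤP.+-identityˡ _)

all-colours? : {P : Col → Set} → (∀ c → Dec (P c)) → Dec (∀ c → P c)
all-colours? P? = map′ (λ (a , b , c) → λ { m1 → a ; z0 → b ; p1 → c }) (λ f → f m1 , f z0 , f p1)
                       (P? m1 ×-dec P? z0 ×-dec P? p1)

all-signs? : {P : Sgn → Set} → (∀ s → Dec (P s)) → Dec (∀ s → P s)
all-signs? P? = map′ (λ (a , b) → λ { plus → a ; minus → b }) (λ f → f plus , f minus) (P? plus ×-dec P? minus)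

all-roots? : {P : Root → Set} → (∀ k → Dec (P k)) → Dec (∀ k → P k)
all-roots? P? = map′ (λ (a , b) → λ { α₁ → a ; α₂ → b }) (λ f → f α₁ , f α₂) (P? α₁ ×-dec P? α₂)

for-H-rules : {P : Col → Col → Col → Col → Set} (P? : ∀ j j' jl jr → Dec (P j j' jl jr)) →
              {_ : True (P? p1 z0 z0 p1)} {_ : True (P? z0 z0 m1 p1)} {_ : True (P? z0 m1 m1 z0)} →
              ∀ {j j' jl jr} → HRule j j' jl jr → P j j' jl jr
for-H-rules _ {t} h10          = toWitness t
for-H-rules _ {_} {t} h00      = toWitness t
for-H-rules _ {_} {_} {t} h0-1 = toWitness t

for-Y-rules : {P : Col → Col → Col → Set} (P? : ∀ j j' jn → Dec (P j j' jn)) →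
              {_ : True (P? p1 z0 p1)} {_ : True (P? z0 m1 m1)} {_ : True (P? p1 m1 z0)} →
              ∀ {j j' jn} → YRule j j' jn → P j j' jn
for-Y-rules _ {t} y10          = toWitness t
for-Y-rules _ {_} {t} y0-1     = toWitness t
for-Y-rules _ {_} {_} {t} y1-1 = toWitness t

-- In the excess laws the
-- totals agree because both a growth rule and a vertex with three distinct colours conserve weight.
H-excess : ∀ {j j' jl jr} → HRule j j' jl jr → ∀ s k x y h p q → Rainbow x h p → Rainbow y h q →
  excess k (s , j) x ℤ.+ excess k (negS s , j') y ≡ excess k (negS s , jl) p ℤ.+ excess k (s , jr) q
  × (excess k (negS s , jl) p ℤ.≤ excess k (s , j) x ⊎ + 0 ℤ.≤ excess k (s , j) x)
H-excess = for-H-rules λ j j' jl jr → all-signs? λ s → all-roots? λ k →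
  all-colours? λ x → all-colours? λ y → all-colours? λ h → all-colours? λ p → all-colours? λ q →
  rainbow? x h p →-dec rainbow? y h q →-dec
    (excess k (s , j) x ℤ.+ excess k (negS s , j') y ℤ.≟ excess k (negS s , jl) p ℤ.+ excess k (s , jr) q)
    ×-dec (excess k (negS s , jl) p ℤ.≤? excess k (s , j) x ⊎-dec + 0 ℤ.≤? excess k (s , j) x)

Y-excess : ∀ {j j' jn} → YRule j j' jn → ∀ s k x y p → Rainbow x y p →
  excess k (s , j) x ℤ.+ excess k (s , j') y ≡ excess k (negS s , jn) p
  × (excess k (negS s , jn) p ℤ.≤ excess k (s , j) x ⊎ + 0 ℤ.≤ excess k (s , j) x)
Y-excess = for-Y-rules λ j j' jn → all-signs? λ s → all-roots? λ k →
  all-colours? λ x → all-colours? λ y → all-colours? λ p →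
  rainbow? x y p →-dec
    (excess k (s , j) x ℤ.+ excess k (s , j') y ℤ.≟ excess k (negS s , jn) p)
    ×-dec (excess k (negS s , jn) p ℤ.≤? excess k (s , j) x ⊎-dec + 0 ℤ.≤? excess k (s , j) x)

J-excess : ∀ s k x → excess k (s , p1) x ℤ.+ excess k (negS s , m1) x ≡ + 0 × + 0 ℤ.≤ excess k (s , p1) x
J-excess = toWitness {a? = all-signs? λ s → all-roots? λ k → all-colours? λ x →
  (excess k (s , p1) x ℤ.+ excess k (negS s , m1) x ℤ.≟ + 0) ×-dec + 0 ℤ.≤? excess k (s , p1) x} _

H-canonical : ∀ {j j' jl jr} → HRule j j' jl jr → ∀ s →
  Rainbow (boundaryColor (s , j)) (boundaryColor (s , m1)) (boundaryColor (negS s , jl))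
  × Rainbow (boundaryColor (negS s , j')) (boundaryColor (s , m1)) (boundaryColor (s , jr))
H-canonical = for-H-rules λ j j' jl jr → all-signs? λ s →
  rainbow? (boundaryColor (s , j)) (boundaryColor (s , m1)) (boundaryColor (negS s , jl))
  ×-dec rainbow? (boundaryColor (negS s , j')) (boundaryColor (s , m1)) (boundaryColor (s , jr))

H-rigid : ∀ {j j' jl jr} → HRule j j' jl jr → ∀ s h p q →
  Rainbow (boundaryColor (s , j)) h p → Rainbow (boundaryColor (negS s , j')) h q →
  (∀ k → + 0 ℤ.≤ excess k (negS s , jl) p) →
  h ≡ boundaryColor (s , m1) × p ≡ boundaryColor (negS s , jl) × q ≡ boundaryColor (s , jr)
H-rigid = for-H-rules λ j j' jl jr → all-signs? λ s → all-colours? λ h → all-colours? λ p → all-colours? λ q →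
  rainbow? (boundaryColor (s , j)) h p →-dec rainbow? (boundaryColor (negS s , j')) h q →-dec
    (all-roots? λ k → + 0 ℤ.≤? excess k (negS s , jl) p) →-dec
    (h ≟ᶜ boundaryColor (s , m1) ×-dec p ≟ᶜ boundaryColor (negS s , jl) ×-dec q ≟ᶜ boundaryColor (s , jr))

Y-canonical : ∀ {j j' jn} → YRule j j' jn → ∀ s →
  Rainbow (boundaryColor (s , j)) (boundaryColor (s , j')) (boundaryColor (negS s , jn))
Y-canonical = for-Y-rules λ j j' jn → all-signs? λ s →
  rainbow? (boundaryColor (s , j)) (boundaryColor (s , j')) (boundaryColor (negS s , jn))

Y-rigid : ∀ {j j' jn} → YRule j j' jn → ∀ s p →
  Rainbow (boundaryColor (s , j)) (boundaryColor (s , j')) p → p ≡ boundaryColor (negS s , jn)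
Y-rigid = for-Y-rules λ j j' jn → all-signs? λ s → all-colours? λ p →
  rainbow? (boundaryColor (s , j)) (boundaryColor (s , j')) p →-dec p ≟ᶜ boundaryColor (negS s , jn)

J-canonical : ∀ s → boundaryColor (negS s , m1) ≡ boundaryColor (s , p1)
J-canonical plus  = refl
J-canonical minus = refl

-- An end of an edge or a dangling edge at a vertex, with the colour of the edge or the one its label requires.
Slot : Set
Slot = ℕ × Col

Compatible : Slot → Slot → Set
Compatible (v , c) (v' , c') = v ≡ v' → c ≢ c'

ColouredEdge : Set
ColouredEdge = (ℕ × ℕ) × Col

edgeSlots : List ColouredEdge → List Slot
edgeSlots []                    = []
edgeSlots (((a , b) , c) ∷ ces) = (a , c) ∷ (b , c) ∷ edgeSlots ces

danglingSlot : ℕ × Label → Slot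
danglingSlot (v , l) = v , boundaryColor l

slots : List ColouredEdge → List (ℕ × Label) → List Slot
slots ces ds = map danglingSlot ds ++ edgeSlots ces

at : ℕ → Col → Col → Col → List Slot
at v a b c = (v , a) ∷ (v , b) ∷ (v , c) ∷ []

at-compatible : ∀ {v a b c} → Rainbow a b c → AllPairs Compatible (at v a b c)
at-compatible ((a≢b ∷ a≢c ∷ []) ∷ (b≢c ∷ []) ∷ [] ∷ []) =
  ((λ _ → a≢b) ∷ (λ _ → a≢c) ∷ []) ∷ ((λ _ → b≢c) ∷ []) ∷ [] ∷ []

at-apart : ∀ {v v' a b c a' b' c'} → v ≢ v' → All (λ s → All (Compatible s) (at v' a' b' c')) (at v a b c)
at-apart {v} {v'} {a' = a'} {b'} {c'} v≢v' = far ∷ far ∷ far ∷ []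
  where
  far : ∀ {d} → All (Compatible (v , d)) (at v' a' b' c')
  far = (λ e → contradiction e v≢v') ∷ (λ e → contradiction e v≢v') ∷ (λ e → contradiction e v≢v') ∷ []

colourOf : (ces : List ColouredEdge) → EdgeColoring (map proj₁ ces)
colourOf (ce ∷ _)   zero    = proj₂ ce
colourOf (_ ∷ ces) (suc i) = colourOf ces i

slot-of : ∀ ces (i : Fin (length (map proj₁ ces))) {z} → Incident (lookup (map proj₁ ces) i) z →
          (z , colourOf ces i) ∈ edgeSlots ces
slot-of (_ ∷ _)   zero    (inj₁ refl) = here refl
slot-of (_ ∷ _)   zero    (inj₂ refl) = there (here refl)
slot-of (_ ∷ ces) (suc i) z∈i         = there (there (slot-of ces i z∈i))

head-apart : ∀ {ce ces} → AllPairs Compatible (edgeSlots (ce ∷ ces)) → ∀ {z} j →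
             Incident (proj₁ ce) z → Incident (lookup (map proj₁ ces) j) z → proj₂ ce ≢ colourOf ces j
head-apart {ces = ces} (ca ∷ _)      j (inj₁ refl) z∈j = All.lookup (All.tail ca) (slot-of ces j z∈j) refl
head-apart {ces = ces} (_ ∷ cb ∷ _) j (inj₂ refl) z∈j = All.lookup cb (slot-of ces j z∈j) refl

colourOf-proper : ∀ {ces} → AllPairs Compatible (edgeSlots ces) → ∀ {z} i j → i ≢ j →
                  Incident (lookup (map proj₁ ces) i) z → Incident (lookup (map proj₁ ces) j) z →
                  colourOf ces i ≢ colourOf ces j
colourOf-proper {_ ∷ _} _ zero zero i≢j _ _ = contradiction refl i≢j
colourOf-proper {_ ∷ _} P zero (suc j) _ z∈0 z∈j = head-apart P j z∈0 z∈j
colourOf-proper {_ ∷ _} P (suc i) zero _ z∈i z∈0 = ≢-sym (head-apart P i z∈0 z∈i)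
colourOf-proper {_ ∷ _} (_ ∷ _ ∷ P) (suc i) (suc j) i≢j = colourOf-proper P i j (i≢j ∘ cong suc)

paint : ∀ {N es ds N' es' ds'} → Step (st N es ds) (st N' es' ds') → List ColouredEdge
paint {N} (H _ _ u v s {j} {j'} _) =
  ((u , N) , boundaryColor (s , j)) ∷ ((v , suc N) , boundaryColor (negS s , j'))
  ∷ ((N , suc N) , boundaryColor (s , m1)) ∷ []
paint (J _ _ u v s) = ((u , v) , boundaryColor (s , p1)) ∷ []
paint {N} (Y _ _ u v s {j} {j'} _) = ((u , N) , boundaryColor (s , j)) ∷ ((v , N) , boundaryColor (s , j')) ∷ []

paint-edges : ∀ {N es ds N' es' ds'} (σ : Step (st N es ds) (st N' es' ds')) → map proj₁ (paint σ) ++ es ≡ es'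
paint-edges (H _ _ _ _ _ _) = refl
paint-edges (J _ _ _ _ _)   = refl
paint-edges (Y _ _ _ _ _ _) = refl

newSlots : ∀ {N es ds N' es' ds'} → Step (st N es ds) (st N' es' ds') → List Slot
newSlots {N} (H _ _ _ _ s {j} {j'} {jl} {jr} _) =
  at N (boundaryColor (s , j)) (boundaryColor (s , m1)) (boundaryColor (negS s , jl))
  ++ at (suc N) (boundaryColor (negS s , j')) (boundaryColor (s , m1)) (boundaryColor (s , jr))
newSlots (J _ _ _ _ _) = []
newSlots {N} (Y _ _ _ _ s {j} {j'} {jn} _) =
  at N (boundaryColor (s , j)) (boundaryColor (s , j')) (boundaryColor (negS s , jn))

step-≤ : ∀ {N es ds N' es' ds'} → Step (st N es ds) (st N' es' ds') → N ≤ N'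
step-≤ {N} (H _ _ _ _ _ _) = ≤-trans (n≤1+n N) (n≤1+n (suc N))
step-≤ (J _ _ _ _ _)       = ≤-refl
step-≤ {N} (Y _ _ _ _ _ _) = n≤1+n N

newSlots-fresh : ∀ {N es ds N' es' ds'} (σ : Step (st N es ds) (st N' es' ds')) →
                 All (λ s → N ≤ proj₁ s × proj₁ s < N') (newSlots σ)
newSlots-fresh {N} (H _ _ _ _ _ _) = atN ∷ atN ∷ atN ∷ atN+1 ∷ atN+1 ∷ atN+1 ∷ []
  where
  atN   = ≤-refl , ℕP.<-trans (ℕP.n<1+n N) (ℕP.n<1+n (suc N))
  atN+1 = n≤1+n N , ℕP.n<1+n (suc N)
newSlots-fresh (J _ _ _ _ _) = []
newSlots-fresh {N} (Y _ _ _ _ _ _) = atN ∷ atN ∷ atN ∷ []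
  where atN = ≤-refl , ℕP.n<1+n N

newSlots-compatible : ∀ {N es ds N' es' ds'} (σ : Step (st N es ds) (st N' es' ds')) →
                      AllPairs Compatible (newSlots σ)
newSlots-compatible {N} (H _ _ _ _ s r) =
  AllPairs.++⁺ (at-compatible (proj₁ (H-canonical r s))) (at-compatible (proj₂ (H-canonical r s)))
               (at-apart (<⇒≢ (ℕP.n<1+n N)))
newSlots-compatible (J _ _ _ _ _)   = []
newSlots-compatible (Y _ _ _ _ s r) = at-compatible (Y-canonical r s)

module SlotBags = Algebra.Solver.CommutativeMonoid (++-commutativeMonoid {A = Slot})

step-slots : ∀ {N es ds N' es' ds'} (σ : Step (st N es ds) (st N' es' ds')) ces →
             slots (paint σ ++ ces) ds' ↭ newSlots σ ++ slots ces ds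
step-slots {N} (H L R u v s {j} {j'} {jl} {jr} _) ces
  rewrite map-++ danglingSlot L ((N , (negS s , jl)) ∷ (suc N , (s , jr)) ∷ R)
        | map-++ danglingSlot L ((u , (s , j)) ∷ (v , (negS s , j')) ∷ R) =
  solve 11 (λ dl dr e ux vy nx nh nla n1y n1h n1lb →
              (dl ⊕ nla ⊕ n1lb ⊕ dr) ⊕ ux ⊕ nx ⊕ vy ⊕ n1y ⊕ nh ⊕ n1h ⊕ e
              ⊜ (nx ⊕ nh ⊕ nla ⊕ n1y ⊕ n1h ⊕ n1lb) ⊕ (dl ⊕ ux ⊕ vy ⊕ dr) ⊕ e)
        ↭-refl (map danglingSlot L) (map danglingSlot R) (edgeSlots ces)
        [ u , x ] [ v , y ] [ N , x ] [ N , h ] [ N , boundaryColor (negS s , jl) ]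
        [ suc N , y ] [ suc N , h ] [ suc N , boundaryColor (s , jr) ]
  where
  open SlotBags
  x = boundaryColor (s , j)
  y = boundaryColor (negS s , j')
  h = boundaryColor (s , m1)
step-slots (J L R u v s) ces
  rewrite map-++ danglingSlot L R
        | map-++ danglingSlot L ((u , (s , p1)) ∷ (v , (negS s , m1)) ∷ R)
        | J-canonical s =
  solve 5 (λ dl dr e ux vx → (dl ⊕ dr) ⊕ ux ⊕ vx ⊕ e ⊜ (dl ⊕ ux ⊕ vx ⊕ dr) ⊕ e)
        ↭-refl (map danglingSlot L) (map danglingSlot R) (edgeSlots ces)
        [ u , boundaryColor (s , p1) ] [ v , boundaryColor (s , p1) ]
  where open SlotBags
step-slots {N} (Y L R u v s {j} {j'} {jn} _) ces
  rewrite map-++ danglingSlot L ((N , (negS s , jn)) ∷ R)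
        | map-++ danglingSlot L ((u , (s , j)) ∷ (v , (s , j')) ∷ R) =
  solve 8 (λ dl dr e ux vy nx ny nln →
             (dl ⊕ nln ⊕ dr) ⊕ ux ⊕ nx ⊕ vy ⊕ ny ⊕ e ⊜ (nx ⊕ ny ⊕ nln) ⊕ (dl ⊕ ux ⊕ vy ⊕ dr) ⊕ e)
        ↭-refl (map danglingSlot L) (map danglingSlot R) (edgeSlots ces)
        [ u , x ] [ v , y ] [ N , x ] [ N , y ] [ N , boundaryColor (negS s , jn) ]
  where
  open SlotBags
  x = boundaryColor (s , j)
  y = boundaryColor (s , j')

persist : ∀ {N es ds N' es' ds'} → Step (st N es ds) (st N' es' ds') → Fin (length es) → Fin (length es')
persist (H _ _ _ _ _ _) p = suc (suc (suc p))
persist (J _ _ _ _ _)   p = suc p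
persist (Y _ _ _ _ _ _) p = suc (suc p)

lookup-persist : ∀ {N es ds N' es' ds'} (σ : Step (st N es ds) (st N' es' ds')) p → lookup es' (persist σ p) ≡ lookup es p
lookup-persist (H _ _ _ _ _ _) _ = refl
lookup-persist (J _ _ _ _ _)   _ = refl
lookup-persist (Y _ _ _ _ _ _) _ = refl

persist-injective : ∀ {N es ds N' es' ds'} (σ : Step (st N es ds) (st N' es' ds')) {p q} →
                    persist σ p ≡ persist σ q → p ≡ q
persist-injective (H _ _ _ _ _ _) refl = refl
persist-injective (J _ _ _ _ _)   refl = refl
persist-injective (Y _ _ _ _ _ _) refl = refl

initDangling-labels : ∀ m ws →
  All (λ d → Σ (Fin (length ws)) λ i → proj₁ d ≡ m ℕ.+ toℕ i × proj₂ d ≡ lookup ws i) (initDangling m ws)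
initDangling-labels m []       = []
initDangling-labels m (l ∷ ws) =
  (zero , sym (ℕP.+-identityʳ m) , refl)
  ∷ All.map (λ (i , v≡ , l≡) → suc i , trans v≡ (sym (ℕP.+-suc m (toℕ i))) , l≡) (initDangling-labels (suc m) ws)

initDangling-distinct : ∀ m ws → AllPairs (λ d d' → proj₁ d ≢ proj₁ d') (initDangling m ws)
initDangling-distinct m []       = []
initDangling-distinct m (l ∷ ws) =
  All.map (λ (i , v≡ , _) m≡v → <⇒≢ (ℕ.s≤s (ℕP.m≤m+n m (toℕ i))) (trans m≡v v≡))
          (initDangling-labels (suc m) ws)
  ∷ initDangling-distinct (suc m) ws

module Existence (w : List Label) where

  n : ℕ
  n = length w

  BoundarySlot : Slot → Set
  BoundarySlot (v , c) = ∀ (k : Fin n) → v ≡ toℕ k → c ≡ boundaryColor (lookup w k)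

  record Sound (N : ℕ) (ss : List Slot) : Set where
    field
      n≤N      : n ≤ N
      bounded  : All (λ s → proj₁ s < N) ss
      rainbow  : AllPairs Compatible ss
      boundary : All BoundarySlot ss

  sound-resp-↭ : ∀ {N ss ts} → ss ↭ ts → Sound N ss → Sound N ts
  sound-resp-↭ p S = record
    { n≤N      = n≤N
    ; bounded  = All-resp-↭ p bounded
    ; rainbow  = Perm.AllPairs-resp-↭ (setoid Slot) (λ c e → ≢-sym (c (sym e)))
                   ((λ { refl c → c }) , (λ { refl c → c })) (↭⇒↭ₛ p) rainbow
    ; boundary = All-resp-↭ p boundary
    }
    where open Sound S

  grow : ∀ {N N' ss new} → Sound N ss → N ≤ N' → All (λ s → N ≤ proj₁ s × proj₁ s < N') new →
         AllPairs Compatible new → Sound N' (new ++ ss)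
  grow {N} S N≤N' fresh new-rainbow = record
    { n≤N      = ≤-trans n≤N N≤N'
    ; bounded  = All.++⁺ (All.map proj₂ fresh) (All.map (λ v<N → <-≤-trans v<N N≤N') bounded)
    ; rainbow  = AllPairs.++⁺ new-rainbow rainbow
                   (All.map (λ (N≤v , _) → All.map (λ u<N v≡u → ⊥-elim (apart N≤v u<N v≡u)) bounded) fresh)
    ; boundary = All.++⁺ (All.map (λ (N≤v , _) k v≡k → ⊥-elim (apart N≤v (<-≤-trans (toℕ<n k) n≤N) v≡k)) fresh)
                         boundary
    }
    where
    open Sound S
    apart : ∀ {u v} → N ≤ v → u < N → v ≢ u
    apart N≤v u<N v≡u = <⇒≢ (<-≤-trans u<N N≤v) (sym v≡u)

  step-sound : ∀ {N es ds N' es' ds' ces} (σ : Step (st N es ds) (st N' es' ds')) →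
               Sound N (slots ces ds) → Sound N' (slots (paint σ ++ ces) ds')
  step-sound {ces = ces} σ S =
    sound-resp-↭ (↭-sym (step-slots σ ces)) (grow S (step-≤ σ) (newSlots-fresh σ) (newSlots-compatible σ))

  sound-run : ∀ {N es ds Nf esf} → Star Step (st N es ds) (st Nf esf []) → ∀ ces → map proj₁ ces ≡ es →
              Sound N (slots ces ds) → Σ (List ColouredEdge) λ cf → map proj₁ cf ≡ esf × Sound Nf (edgeSlots cf)
  sound-run ε       ces eq   S = ces , eq , S
  sound-run (_◅_ {j = st _ _ _} σ ρ) ces refl S =
    sound-run ρ (paint σ ++ ces) (trans (map-++ proj₁ (paint σ) ces) (paint-edges σ)) (step-sound σ S)

  initial-sound : Sound n (slots [] (initDangling 0 w))
  initial-sound = subst (Sound n) (sym (++-identityʳ _)) record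
    { n≤N      = ≤-refl
    ; bounded  = All.map⁺ (All.map (λ (i , v≡i , _) → subst (_< n) (sym v≡i) (toℕ<n i)) labels)
    ; rainbow  = AllPairs.map⁺ (AllPairs.map (λ v≢v' v≡v' → contradiction v≡v' v≢v') (initDangling-distinct 0 w))
    ; boundary = All.map⁺ (All.map (λ (i , v≡i , l≡wᵢ) k v≡k →
                   cong boundaryColor (trans l≡wᵢ (cong (lookup w) (toℕ-injective (trans (sym v≡i) v≡k))))) labels)
    }
    where labels = initDangling-labels 0 w

  existence : ∀ {es} → GrowsTo w es → Σ (EdgeColoring es) (GoodColoring w es)
  existence (_ , ρ) with sound-run ρ [] refl initial-sound
  ... | cf , refl , S =
    colourOf cf , (λ _ _ i j → colourOf-proper rainbow i j) , λ k e k∈e → All.lookup boundary (slot-of cf e k∈e) k refl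
    where open Sound S

module Runs (Nf : ℕ) (esf : List (ℕ × ℕ)) where

  Pos : Set
  Pos = Fin (length esf)

  Run : State → Set
  Run S = Star Step S (st Nf esf [])

  embed : ∀ {N es ds} → Run (st N es ds) → Fin (length es) → Pos
  embed ε                             = λ p → p
  embed (_◅_ {j = st _ _ _} σ ρ) = embed ρ ∘ persist σ

  lookup-embed : ∀ {N es ds} (ρ : Run (st N es ds)) p → lookup esf (embed ρ p) ≡ lookup es p
  lookup-embed ε                        _ = refl
  lookup-embed (_◅_ {j = st _ _ _} σ ρ) p = trans (lookup-embed ρ (persist σ p)) (lookup-persist σ p)

  embed-injective : ∀ {N es ds} (ρ : Run (st N es ds)) {p q} → embed ρ p ≡ embed ρ q → p ≡ q
  embed-injective ε                        e = e
  embed-injective (_◅_ {j = st _ _ _} σ ρ) e = persist-injective σ (embed-injective ρ e)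

  Fresh : ∀ {N es ds} → Run (st N es ds) → Pos → Set
  Fresh ρ t = ∀ p → embed ρ p ≢ t

  -- The edge of the final web that will continue a dangling edge hanging from v.
  record Future {N es ds} (ρ : Run (st N es ds)) (v : ℕ) : Set where
    constructor future
    field
      edge     : Pos
      incident : Incident (lookup esf edge) v
      fresh    : Fresh ρ edge

  open Future

  later : ∀ {N es ds N' es' ds' v} (σ : Step (st N es ds) (st N' es' ds')) (ρ : Run (st N' es' ds')) →
          Future ρ v → Future (σ ◅ ρ) v
  later σ ρ f = future (edge f) (incident f) (fresh f ∘ persist σ)

  created : ∀ {N es ds N' es' ds' v} (σ : Step (st N es ds) (st N' es' ds')) (ρ : Run (st N' es' ds')) i →
            (∀ p → persist σ p ≢ i) → Incident (lookup es' i) v → Future (σ ◅ ρ) v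
  created σ ρ i new v∈i = future (embed ρ i) (subst (λ e → Incident e _) (sym (lookup-embed ρ i)) v∈i)
                                 (λ p e → new p (embed-injective ρ e))

  futures : ∀ {N es ds} (ρ : Run (st N es ds)) → All (λ d → Future ρ (proj₁ d)) ds
  futures ε = []
  futures (_◅_ {j = st _ _ _} σ@(H L R _ _ _ _) ρ) =
    splice L (_ ∷ _ ∷ []) {R = R} (later σ ρ)
      (created σ ρ zero (λ _ ()) (inj₁ refl) ∷ created σ ρ (suc zero) (λ _ ()) (inj₁ refl) ∷ []) (futures ρ)
  futures (_◅_ {j = st _ _ _} σ@(J L R _ _ _) ρ) =
    splice L [] {R = R} (later σ ρ)
      (created σ ρ zero (λ _ ()) (inj₁ refl) ∷ created σ ρ zero (λ _ ()) (inj₂ refl) ∷ []) (futures ρ)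
  futures (_◅_ {j = st _ _ _} σ@(Y L R _ _ _ _) ρ) =
    splice L (_ ∷ []) {R = R} (later σ ρ)
      (created σ ρ zero (λ _ ()) (inj₁ refl) ∷ created σ ρ (suc zero) (λ _ ()) (inj₁ refl) ∷ []) (futures ρ)

  module Observed (c : Pos → Col) where

    observations : ∀ {N es ds} → Run (st N es ds) → List (Label × Col)
    observations ρ = All.reduce (λ {d} f → proj₂ d , c (edge f)) (futures ρ)

    splice-view : ∀ {N es ds N' es'} L M' {M R} (σ : Step (st N es ds) (st N' es' (L ++ M' ++ R)))
                  (ρ : Run (st N' es' (L ++ M' ++ R))) (qs : All (λ d → Future (σ ◅ ρ) (proj₁ d)) M) →
                  Spliced (All.reduce (λ {d} f → proj₂ d , c (edge f)) (splice L M' (later σ ρ) qs (futures ρ)))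
                          (observations ρ)
                          (All.reduce (λ {d} f → proj₂ d , c (edge f)) qs)
                          (All.reduce (λ {d} f → proj₂ d , c (edge f)) (All.++⁻ˡ M' (All.++⁻ʳ L (futures ρ))))
    splice-view L M' σ ρ qs = record
      { left  = All.reduce g (All.++⁻ˡ L (futures ρ))
      ; right = All.reduce g (All.++⁻ʳ M' (All.++⁻ʳ L (futures ρ)))
      ; xs≡   = reduce-splice _ L M' (later σ ρ) qs (futures ρ)
      ; xs'≡  = trans (reduce-++⁻ g L (futures ρ))
                      (cong (All.reduce g (All.++⁻ˡ L (futures ρ)) ++_) (reduce-++⁻ g M' (All.++⁻ʳ L (futures ρ))))
      }
      where
      g : ∀ {d} → Future ρ (proj₁ d) → Label × Col
      g {d} f = proj₂ d , c (edge f)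

    H-view : ∀ {N es L R u v s j j' jl jr} (r : HRule j j' jl jr)
             (ρ : Run (st (suc (suc N)) ((u , N) ∷ (v , suc N) ∷ (N , suc N) ∷ es)
                         (L ++ (N , (negS s , jl)) ∷ (suc N , (s , jr)) ∷ R))) →
             Σ (Future ρ N) λ f₀ → Σ (Future ρ (suc N)) λ f₁ →
             Spliced (observations (H L R u v s r ◅ ρ)) (observations ρ)
                     (((s , j) , c (embed ρ zero)) ∷ ((negS s , j') , c (embed ρ (suc zero))) ∷ [])
                     (((negS s , jl) , c (edge f₀)) ∷ ((s , jr) , c (edge f₁)) ∷ [])
    H-view {L = L} r ρ
      with All.++⁻ˡ (_ ∷ _ ∷ []) (All.++⁻ʳ L (futures ρ)) | splice-view L (_ ∷ _ ∷ []) (H L _ _ _ _ r) ρ _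
    ... | f₀ ∷ f₁ ∷ [] | view = f₀ , f₁ , view

    J-view : ∀ {N es L R u v s} (ρ : Run (st N ((u , v) ∷ es) (L ++ R))) →
             Spliced (observations (J L R u v s ◅ ρ)) (observations ρ)
                     (((s , p1) , c (embed ρ zero)) ∷ ((negS s , m1) , c (embed ρ zero)) ∷ []) []
    J-view {L = L} ρ = splice-view L [] (J L _ _ _ _) ρ _

    Y-view : ∀ {N es L R u v s j j' jn} (r : YRule j j' jn)
             (ρ : Run (st (suc N) ((u , N) ∷ (v , N) ∷ es) (L ++ (N , (negS s , jn)) ∷ R))) →
             Σ (Future ρ N) λ f₀ →
             Spliced (observations (Y L R u v s r ◅ ρ)) (observations ρ)
                     (((s , j) , c (embed ρ zero)) ∷ ((s , j') , c (embed ρ (suc zero))) ∷ [])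
                     (((negS s , jn) , c (edge f₀)) ∷ [])
    Y-view {L = L} r ρ
      with All.++⁻ˡ (_ ∷ []) (All.++⁻ʳ L (futures ρ)) | splice-view L (_ ∷ []) (Y L _ _ _ _ r) ρ _
    ... | f₀ ∷ [] | view = f₀ , view

module Uniqueness (w : List Label) {Nf : ℕ} {esf : List (ℕ × ℕ)} where

  open Runs Nf esf
  open Future

  n : ℕ
  n = length w

  initial-canonical : ∀ {c} (ρ : Run (initState w)) → BoundaryOK w esf c → Canonical (Observed.observations c ρ)
  initial-canonical {c} ρ boundary = reduce-all _ canonical (futures ρ) (initDangling-labels 0 w)
    where
    canonical : ∀ {d} (f : Future ρ (proj₁ d)) → (Σ (Fin n) λ i → proj₁ d ≡ toℕ i × proj₂ d ≡ lookup w i) →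
                c (edge f) ≡ boundaryColor (proj₂ d)
    canonical f (i , v≡i , l≡wᵢ) =
      trans (boundary i (edge f) (subst (Incident _) v≡i (incident f))) (cong boundaryColor (sym l≡wᵢ))

  module Coloured (c : Pos → Col) (proper : Proper n esf c) where

    open Observed c

    rainbow-at : ∀ {N es ds v} (ρ : Run (st N es ds)) → n ≤ v → ∀ i j → i ≢ j →
                 Incident (lookup es i) v → Incident (lookup es j) v → (f : Future ρ v) →
                 Rainbow (c (embed ρ i)) (c (embed ρ j)) (c (edge f))
    rainbow-at ρ n≤v i j i≢j v∈i v∈j f =
      (proper _ n≤v _ _ (i≢j ∘ embed-injective ρ) v∈i' v∈j'
       ∷ proper _ n≤v _ _ (fresh f i) v∈i' (incident f) ∷ [])
      ∷ (proper _ n≤v _ _ (fresh f j) v∈j' (incident f) ∷ [])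
      ∷ [] ∷ []
      where
      v∈i' = subst (λ e → Incident e _) (sym (lookup-embed ρ i)) v∈i
      v∈j' = subst (λ e → Incident e _) (sym (lookup-embed ρ j)) v∈j

    H-rainbows : ∀ {N es ds' u v} (ρ : Run (st (suc (suc N)) ((u , N) ∷ (v , suc N) ∷ (N , suc N) ∷ es) ds')) →
                 n ≤ N → (f₀ : Future ρ N) (f₁ : Future ρ (suc N)) →
                 Rainbow (c (embed ρ zero)) (c (embed ρ (suc (suc zero)))) (c (edge f₀))
                 × Rainbow (c (embed ρ (suc zero))) (c (embed ρ (suc (suc zero)))) (c (edge f₁))
    H-rainbows ρ n≤N f₀ f₁ =
      rainbow-at ρ n≤N zero (suc (suc zero)) (λ ()) (inj₂ refl) (inj₁ refl) f₀ ,
      rainbow-at ρ (ℕP.m≤n⇒m≤1+n n≤N) (suc zero) (suc (suc zero)) (λ ()) (inj₂ refl) (inj₂ refl) f₁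

    Y-rainbow : ∀ {N es ds' u v} (ρ : Run (st (suc N) ((u , N) ∷ (v , N) ∷ es) ds')) → n ≤ N → (f₀ : Future ρ N) →
                Rainbow (c (embed ρ zero)) (c (embed ρ (suc zero))) (c (edge f₀))
    Y-rainbow ρ n≤N = rainbow-at ρ n≤N zero (suc zero) (λ ()) (inj₂ refl) (inj₂ refl)

    dominated : ∀ {N es ds} (ρ : Run (st N es ds)) → n ≤ N → Dominated (observations ρ)
    dominated ε _ _ = tt
    dominated (_◅_ {j = st _ _ _} (H _ _ _ _ s r) ρ) n≤N with H-view r ρ
    ... | f₀ , f₁ , view = spliced-transfer view Dominated
      (λ xs _ D k → let sum≡ , start = H-excess r s k _ _ _ _ _ (proj₁ rainbows) (proj₂ rainbows)
                    in PartialSums.two-for-two (uncurry (excess k)) xs sum≡ start (D k))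
      (dominated ρ (ℕP.m≤n⇒m≤1+n (ℕP.m≤n⇒m≤1+n n≤N)))
      where rainbows = H-rainbows ρ n≤N f₀ f₁
    dominated (_◅_ {j = st _ _ _} (J _ _ _ _ s) ρ) n≤N = spliced-transfer (J-view ρ) Dominated
      (λ xs _ D k → let sum≡ , start = J-excess s k _
                    in PartialSums.two-for-none (uncurry (excess k)) xs sum≡ start (D k))
      (dominated ρ n≤N)
    dominated (_◅_ {j = st _ _ _} (Y _ _ _ _ s r) ρ) n≤N with Y-view r ρ
    ... | f₀ , view = spliced-transfer view Dominated
      (λ xs _ D k → let sum≡ , start = Y-excess r s k _ _ _ (Y-rainbow ρ n≤N f₀)
                    in PartialSums.two-for-one (uncurry (excess k)) xs sum≡ start (D k))
      (dominated ρ (ℕP.m≤n⇒m≤1+n n≤N))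

    H-advance : ∀ {N es L R u v s j j' jl jr} (r : HRule j j' jl jr)
                (ρ : Run (st (suc (suc N)) ((u , N) ∷ (v , suc N) ∷ (N , suc N) ∷ es)
                            (L ++ (N , (negS s , jl)) ∷ (suc N , (s , jr)) ∷ R))) →
                n ≤ N → Canonical (observations (H L R u v s r ◅ ρ)) →
                Canonical (observations ρ)
                × c (embed ρ zero) ≡ boundaryColor (s , j) × c (embed ρ (suc zero)) ≡ boundaryColor (negS s , j')
                × c (embed ρ (suc (suc zero))) ≡ boundaryColor (s , m1)
    H-advance {N} {s = s} r ρ n≤N C with H-view r ρ
    ... | f₀ , f₁ , view with spliced-All⁻ view C
    ... | CL , x≡ ∷ y≡ ∷ [] , CR = spliced-All⁺ view CL (p≡ ∷ q≡ ∷ []) CR , x≡ , y≡ , h≡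
      where
      rainbows = H-rainbows ρ n≤N f₀ f₁
      rigid = H-rigid r s _ _ _
        (subst (λ x → Rainbow x _ _) x≡ (proj₁ rainbows)) (subst (λ y → Rainbow y _ _) y≡ (proj₂ rainbows))
        (canonical-prefix (Spliced.left view) CL
          (subst Dominated (Spliced.xs'≡ view) (dominated ρ (ℕP.m≤n⇒m≤1+n (ℕP.m≤n⇒m≤1+n n≤N)))))
      h≡ = proj₁ rigid
      p≡ = proj₁ (proj₂ rigid)
      q≡ = proj₂ (proj₂ rigid)

    J-advance : ∀ {N es L R u v s} (ρ : Run (st N ((u , v) ∷ es) (L ++ R))) →
                Canonical (observations (J L R u v s ◅ ρ)) →
                Canonical (observations ρ) × c (embed ρ zero) ≡ boundaryColor (s , p1)
    J-advance {L = L} {R} {u} {v} {s} ρ C with J-view {L = L} {R} {u} {v} {s} ρ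
    ... | view with spliced-All⁻ view C
    ... | CL , x≡ ∷ _ ∷ [] , CR = spliced-All⁺ view CL [] CR , x≡

    Y-advance : ∀ {N es L R u v s j j' jn} (r : YRule j j' jn)
                (ρ : Run (st (suc N) ((u , N) ∷ (v , N) ∷ es) (L ++ (N , (negS s , jn)) ∷ R))) →
                n ≤ N → Canonical (observations (Y L R u v s r ◅ ρ)) →
                Canonical (observations ρ)
                × c (embed ρ zero) ≡ boundaryColor (s , j) × c (embed ρ (suc zero)) ≡ boundaryColor (s , j')
    Y-advance {s = s} r ρ n≤N C with Y-view r ρ
    ... | f₀ , view with spliced-All⁻ view C
    ... | CL , x≡ ∷ y≡ ∷ [] , CR = spliced-All⁺ view CL (p≡ ∷ []) CR , x≡ , y≡
      where
      p≡ = Y-rigid r s _ (subst₂ (λ x y → Rainbow x y _) x≡ y≡ (Y-rainbow ρ n≤N f₀))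

  module _ {c₁ c₂ : Pos → Col} (proper₁ : Proper n esf c₁) (proper₂ : Proper n esf c₂) where

    private
      module C₁ = Coloured c₁ proper₁
      module C₂ = Coloured c₂ proper₂

    agree : ∀ {N es ds} (ρ : Run (st N es ds)) → n ≤ N →
            Canonical (Observed.observations c₁ ρ) → Canonical (Observed.observations c₂ ρ) →
            (∀ p → c₁ (embed ρ p) ≡ c₂ (embed ρ p)) → ∀ t → c₁ t ≡ c₂ t
    agree ε _ _ _ same = same
    agree (_◅_ {j = st _ _ _} (H _ _ _ _ _ r) ρ) n≤N C₁ C₂ same
      with C₁.H-advance r ρ n≤N C₁ | C₂.H-advance r ρ n≤N C₂
    ... | C₁' , x₁ , y₁ , h₁ | C₂' , x₂ , y₂ , h₂ =
      agree ρ (ℕP.m≤n⇒m≤1+n (ℕP.m≤n⇒m≤1+n n≤N)) C₁' C₂' λ where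
        zero                → trans x₁ (sym x₂)
        (suc zero)          → trans y₁ (sym y₂)
        (suc (suc zero))    → trans h₁ (sym h₂)
        (suc (suc (suc p))) → same p
    agree (_◅_ {j = st _ _ _} (J _ _ _ _ _) ρ) n≤N C₁ C₂ same
      with C₁.J-advance ρ C₁ | C₂.J-advance ρ C₂
    ... | C₁' , x₁ | C₂' , x₂ =
      agree ρ n≤N C₁' C₂' λ where
        zero    → trans x₁ (sym x₂)
        (suc p) → same p
    agree (_◅_ {j = st _ _ _} (Y _ _ _ _ _ r) ρ) n≤N C₁ C₂ same
      with C₁.Y-advance r ρ n≤N C₁ | C₂.Y-advance r ρ n≤N C₂
    ... | C₁' , x₁ , y₁ | C₂' , x₂ , y₂ =
      agree ρ (ℕP.m≤n⇒m≤1+n n≤N) C₁' C₂' λ where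
        zero          → trans x₁ (sym x₂)
        (suc zero)    → trans y₁ (sym y₂)
        (suc (suc p)) → same p

uniqueness : ∀ w {es} → GrowsTo w es → ∀ {c₁ c₂} → GoodColoring w es c₁ → GoodColoring w es c₂ →
             ∀ e → c₁ e ≡ c₂ e
uniqueness w (_ , ρ) (proper₁ , boundary₁) (proper₂ , boundary₂) =
  agree proper₁ proper₂ ρ ≤-refl (initial-canonical ρ boundary₁) (initial-canonical ρ boundary₂) λ ()
  where open Uniqueness w

-- The dominance of w is what makes the growth algorithm terminate; here the terminating run is given.
lemma3p4 : (w : List Label) → Dominant w → (es : List (ℕ × ℕ)) → GrowsTo w es →
    Σ (EdgeColoring es) (λ c → GoodColoring w es c ×
      ((c' : EdgeColoring es) → GoodColoring w es c' → (e : Fin (length es)) → c' e ≡ c e))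
lemma3p4 w _ es run with Existence.existence w run
... | c , good = c , good , λ c' good' → uniqueness w run good' good
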